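{- Let $a_1,\ldots,a_r,b_1,\ldots,b_r,m$ be positive integers. For each $i$, let $K[a_i,b_i]$ be the balanced complete $b_i$-partite graph in which each partite set contains $a_i$ vertices, and let $X=\prod_{i=1}^r K[a_i,b_i]$ be the direct product of these graphs. Then the number of cliques of order $m$ in $X$ is \[\frac{1}{m!}\prod_{k=1}^m\prod_{i=1}^r \mathcal S_{k-1}(a_i,b_i),\] where $\mathcal S_j(x,y)=\max\{x(y-j),0\}$.
   Context: All graphs are finite and simple (no loops). A complete $b$-partite graph is a graph whose vertex set is partitioned into $b$ parts (partite sets) such that two vertices are adjacent if and only if they lie in different parts; it is balanced if all parts have the same size. $K[a,b]$ denotes the balanced complete $b$-partite graph with $a$ vertices in each part (so $ab$ vertices in total). The direct product $\prod_{i=1}^r H_i$ of graphs $H_1,\ldots,H_r$ has vertex set $V(H_1)\times\cdots\times V(H_r)$, and two vertices $(y_1,\ldots,y_r)$ and $(z_1,\ldots,z_r)$ are adjacent if and only if $y_i$ is adjacent to $z_i$ in $H_i$ for every $1\le i\le r$. A clique of order $m$ is a set of $m$ distinct, pairwise adjacent vertices. For integers $x,y\ge 1$ and $j\ge 0$, $\mathcal S_j(x,y)=\max\{x(y-j),0\}$. -}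

module Defs where

open import Data.Nat using (ℕ; zero; suc; _*_; _∸_)
open import Data.Fin using (Fin; remQuot; quotient; _≟_)
open import Data.Fin.Properties using (all?)
open import Data.Fin.Subset using (Subset; _∈_; ∣_∣)
open import Data.Fin.Subset.Properties using (_∈?_)
open import Data.Vec using ([]; _∷_)
open import Data.Bool using (true; false)
open import Data.List using (List; []; _∷_; _++_; map; filter; length)
open import Data.Product using (_×_; _,_; proj₁; proj₂)
open import Relation.Nullary using (¬_; Dec)
open import Relation.Nullary.Decidable using (_×-dec_; _→-dec_; ¬?)
open import Relation.Binary using (Decidable)
open import Relation.Binary.PropositionalEquality using (_≡_; _≢_)

record Graph : Set₁ where
  field
    nV   : ℕ
    Adj  : Fin nV → Fin nV → Set
    adj? : Decidable Adj
open Graph public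

-- K[a,b]: vertex set Fin (b * a), identified with Fin b × Fin a via remQuot;
-- the first component is the partite set (b parts of a vertices each).
part : (a b : ℕ) → Fin (b * a) → Fin b
part a b v = quotient {b} a v

K : ℕ → ℕ → Graph
K a b = record
  { nV   = b * a
  ; Adj  = λ u v → part a b u ≢ part a b v
  ; adj? = λ u v → ¬? (part a b u ≟ part a b v)
  }

fstV : (G H : Graph) → Fin (nV G * nV H) → Fin (nV G)
fstV G H u = proj₁ (remQuot {nV G} (nV H) u)

sndV : (G H : Graph) → Fin (nV G * nV H) → Fin (nV H)
sndV G H u = proj₂ (remQuot {nV G} (nV H) u)

_⊗_ : Graph → Graph → Graph
G ⊗ H = record
  { nV   = nV G * nV H
  ; Adj  = λ u v → Adj G (fstV G H u) (fstV G H v) × Adj H (sndV G H u) (sndV G H v)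
  ; adj? = λ u v → adj? G (fstV G H u) (fstV G H v) ×-dec adj? H (sndV G H u) (sndV G H v)
  }

∏G : (r : ℕ) → (Fin (suc r) → Graph) → Graph
∏G zero    H = H Fin.zero
  where import Data.Fin as Fin
∏G (suc r) H = H Fin.zero ⊗ ∏G r (λ i → H (Fin.suc i))
  where import Data.Fin as Fin

IsClique : (G : Graph) → Subset (nV G) → Set
IsClique G s = ∀ u v → u ∈ s → v ∈ s → u ≢ v → Adj G u v

isClique? : (G : Graph) → (s : Subset (nV G)) → Dec (IsClique G s)
isClique? G s = all? λ u → all? λ v →
  (u ∈? s) →-dec ((v ∈? s) →-dec (¬? (u ≟ v) →-dec adj? G u v))

IsCliqueOfOrder : (G : Graph) → ℕ → Subset (nV G) → Set
IsCliqueOfOrder G m s = IsClique G s × ∣ s ∣ ≡ m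

allSubsets : (n : ℕ) → List (Subset n)
allSubsets zero    = [] ∷ []
allSubsets (suc n) = map (true ∷_) (allSubsets n) ++ map (false ∷_) (allSubsets n)

numCliques : (G : Graph) → ℕ → ℕ
numCliques G m =
  length (filter (λ s → isClique? G s ×-dec (∣ s ∣ Data.Nat.≟ m)) (allSubsets (nV G)))
  where import Data.Nat

-- 𝒮_j(x,y) = max{x(y-j),0}; with truncated subtraction this is x * (y ∸ j).
𝒮 : ℕ → ℕ → ℕ → ℕ
𝒮 j x y = x * (y ∸ j)

∏ : (n : ℕ) → (Fin n → ℕ) → ℕ
∏ zero    f = 1
∏ (suc n) f = f Fin.zero * ∏ n (λ i → f (Fin.suc i))
  where import Data.Fin as Fin

∏₁ : ℕ → (ℕ → ℕ) → ℕ
∏₁ zero    f = 1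
∏₁ (suc m) f = ∏₁ m f * f (suc m)

-- Counting ordered cliques instead of unordered ones removes the factor m!: in a
-- loopless symmetric graph, m! times the number of m-cliques is the number of
-- sequences v₁, …, v_m of pairwise adjacent vertices (double count the pairs (v, s)
-- with v ∈ s, and toggle v in s), and such sequences are counted by choosing each vᵢ
-- among the common neighbours of v₁, …, vᵢ₋₁. In a direct product a sequence is a
-- clique exactly when every coordinate sequence is, so the ordered count is
-- multiplicative. In K[a,b] the common neighbours of a j-clique are the vertices of
-- the b − j parts it misses, a(b − j) of them.
module Submission where

open import Defs
open import Data.Bool using (true; false; not; if_then_else_)
open import Data.Empty using (⊥-elim)
open import Data.Fin using (Fin; zero; suc; _↑ˡ_; _↑ʳ_; combine; remQuot; quotient) renaming (_≟_ to _≟ᶠ_)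
open import Data.Fin.Properties using (remQuot-combine; all?)
open import Data.Fin.Subset using (Subset; inside; outside; _∈_; _∉_; ∣_∣; ⁅_⁆; _-_)
open import Data.Fin.Subset.Properties using (_∈?_; ∣⁅x⁆∣≡1; x∈⁅x⁆; x∈⁅y⁆⇒x≡y; x∈p⇒∣p-x∣<∣p∣)
open import Data.List using (List; []; _∷_; _++_; map; filter; length)
open import Data.List.Properties using (filter-++; length-++; length-map)
open import Data.List.Relation.Unary.All as All using (All; []; _∷_)
open import Data.List.Relation.Unary.All.Properties using (map⁺; map⁻)
open import Data.List.Relation.Unary.AllPairs using ([]; _∷_)
open import Data.List.Relation.Unary.Unique.Propositional using (Unique)
open import Data.Nat using (ℕ; zero; suc; _+_; _*_; _∸_; _<_; _>_; _!) renaming (_≟_ to _≟ℕ_)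
open import Data.Nat.Properties
open import Data.Product using (_×_; _,_; proj₁; proj₂)
open import Data.Sum using (_⊎_; inj₁; inj₂)
open import Data.Vec using ([]; _∷_; here; there)
open import Function using (id; _∘_; _⇔_; mk⇔; Equivalence)
open import Relation.Nullary using (¬_; Dec; yes; no; does)
open import Relation.Nullary.Decidable using (_×-dec_; _→-dec_; ¬?)
open import Relation.Unary using (Pred; Decidable)
open import Relation.Binary using (Symmetric)
open import Relation.Binary.PropositionalEquality
open import Algebra.Properties.CommutativeSemigroup *-commutativeSemigroup using (x∙yz≈y∙xz; xy∙z≈y∙xz; interchange)
open import Algebra.Properties.Semiring.Sum +-*-semiring
  using (sum-syntax; sum-cong-≗; ∑-distrib-+; *-distribˡ-sum; *-distribʳ-sum)
open ≡-Reasoning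


𝟙 : ∀ {ℓ} {P : Set ℓ} → Dec P → ℕ
𝟙 d = if does d then 1 else 0

𝟙-cong : ∀ {ℓ ℓ′} {P : Set ℓ} {Q : Set ℓ′} (p : Dec P) (q : Dec Q) → P ⇔ Q → 𝟙 p ≡ 𝟙 q
𝟙-cong (yes _) (yes _) _   = refl
𝟙-cong (yes p) (no ¬q) P⇔Q = ⊥-elim (¬q (Equivalence.to P⇔Q p))
𝟙-cong (no ¬p) (yes q) P⇔Q = ⊥-elim (¬p (Equivalence.from P⇔Q q))
𝟙-cong (no _)  (no _)  _   = refl

𝟙-× : ∀ {ℓ ℓ′} {P : Set ℓ} {Q : Set ℓ′} (p : Dec P) (q : Dec Q) → 𝟙 (p ×-dec q) ≡ 𝟙 p * 𝟙 q
𝟙-× (yes _) q = sym (+-identityʳ (𝟙 q))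
𝟙-× (no _)  q = refl

𝟙-yes : ∀ {ℓ} {P : Set ℓ} (p : Dec P) → P → 𝟙 p ≡ 1
𝟙-yes (yes _) _ = refl
𝟙-yes (no ¬p) p = ⊥-elim (¬p p)

𝟙-no : ∀ {ℓ} {P : Set ℓ} (p : Dec P) → ¬ P → 𝟙 p ≡ 0
𝟙-no (yes p) ¬p = ⊥-elim (¬p p)
𝟙-no (no _)  _  = refl

*-𝟙-cong : ∀ {ℓ} {P : Set ℓ} {m n} (p : Dec P) → (P → m ≡ n) → m * 𝟙 p ≡ n * 𝟙 p
*-𝟙-cong         (yes p) m≡n = cong (_* 1) (m≡n p)
*-𝟙-cong {m = m} {n} (no _) _ = trans (*-zeroʳ m) (sym (*-zeroʳ n))

𝟙-*-cong : ∀ {ℓ} {P : Set ℓ} {m n} (p : Dec P) → (P → m ≡ n) → 𝟙 p * m ≡ 𝟙 p * n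
𝟙-*-cong (yes p) m≡n = cong (_+ 0) (m≡n p)
𝟙-*-cong (no _)  _   = refl

∑-const : ∀ n c → ∑[ i < n ] c ≡ n * c
∑-const zero    c = refl
∑-const (suc n) c = cong (c +_) (∑-const n c)

∑-split : ∀ m n (f : Fin (m + n) → ℕ) →
      ∑[ w < m + n ] f w ≡ ∑[ i < m ] f (i ↑ˡ n) + ∑[ j < n ] f (m ↑ʳ j)
∑-split zero    n f = refl
∑-split (suc m) n f = trans (cong (f zero +_) (∑-split m n (f ∘ suc))) (sym (+-assoc (f zero) _ _))

∑-combine : ∀ m n (f : Fin (m * n) → ℕ) →
            ∑[ w < m * n ] f w ≡ ∑[ i < m ] ∑[ j < n ] f (combine i j)
∑-combine zero    n f = refl
∑-combine (suc m) n f =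
  trans (∑-split n (m * n) f) (cong (∑[ j < n ] f (j ↑ˡ (m * n)) +_) (∑-combine m n (f ∘ (n ↑ʳ_))))

∑-remQuot : ∀ m n (f : Fin m × Fin n → ℕ) →
            ∑[ w < m * n ] f (remQuot n w) ≡ ∑[ i < m ] ∑[ j < n ] f (i , j)
∑-remQuot m n f = trans (∑-combine m n (f ∘ remQuot n))
  (sum-cong-≗ λ i → sum-cong-≗ λ j → cong f (remQuot-combine i j))

-- Sums over all subsets

∑ₛ : (n : ℕ) → (Subset n → ℕ) → ℕ
∑ₛ zero    h = h []
∑ₛ (suc n) h = ∑ₛ n (h ∘ (inside ∷_)) + ∑ₛ n (h ∘ (outside ∷_))

∑ₛ-cong : ∀ n {g h : Subset n → ℕ} → (∀ s → g s ≡ h s) → ∑ₛ n g ≡ ∑ₛ n h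
∑ₛ-cong zero    g≗h = g≗h []
∑ₛ-cong (suc n) g≗h = cong₂ _+_ (∑ₛ-cong n (g≗h ∘ (inside ∷_))) (∑ₛ-cong n (g≗h ∘ (outside ∷_)))

∑ₛ-zero : ∀ n → ∑ₛ n (λ _ → 0) ≡ 0
∑ₛ-zero zero    = refl
∑ₛ-zero (suc n) = cong₂ _+_ (∑ₛ-zero n) (∑ₛ-zero n)

*-distribˡ-∑ₛ : ∀ n c (h : Subset n → ℕ) → c * ∑ₛ n h ≡ ∑ₛ n (λ s → c * h s)
*-distribˡ-∑ₛ zero    c h = refl
*-distribˡ-∑ₛ (suc n) c h = trans (*-distribˡ-+ c (∑ₛ n _) _)
  (cong₂ _+_ (*-distribˡ-∑ₛ n c (h ∘ (inside ∷_))) (*-distribˡ-∑ₛ n c (h ∘ (outside ∷_))))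

∑-∑ₛ-comm : ∀ m n (f : Fin m → Subset n → ℕ) →
            ∑[ i < m ] ∑ₛ n (f i) ≡ ∑ₛ n (λ s → ∑[ i < m ] f i s)
∑-∑ₛ-comm m zero    f = refl
∑-∑ₛ-comm m (suc n) f = begin
  ∑[ i < m ] (∑ₛ n (f i ∘ (inside ∷_)) + ∑ₛ n (f i ∘ (outside ∷_)))
    ≡⟨ ∑-distrib-+ (λ i → ∑ₛ n (f i ∘ (inside ∷_))) _ ⟩
  ∑[ i < m ] ∑ₛ n (f i ∘ (inside ∷_)) + ∑[ i < m ] ∑ₛ n (f i ∘ (outside ∷_))
    ≡⟨ cong₂ _+_ (∑-∑ₛ-comm m n (λ i → f i ∘ (inside ∷_))) (∑-∑ₛ-comm m n (λ i → f i ∘ (outside ∷_))) ⟩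
  ∑ₛ (suc n) (λ s → ∑[ i < m ] f i s) ∎

length-filter-map : ∀ {a b ℓ} {A : Set a} {B : Set b} {P : Pred B ℓ} (P? : Decidable P)
                    (f : A → B) (xs : List A) →
                    length (filter P? (map f xs)) ≡ length (filter (P? ∘ f) xs)
length-filter-map P? f []       = refl
length-filter-map P? f (x ∷ xs) with does (P? (f x))
... | true  = cong suc (length-filter-map P? f xs)
... | false = length-filter-map P? f xs

length-filter-allSubsets : ∀ {ℓ} n {P : Pred (Subset n) ℓ} (P? : Decidable P) →
                           length (filter P? (allSubsets n)) ≡ ∑ₛ n (𝟙 ∘ P?)
length-filter-allSubsets zero    P? with does (P? [])
... | true  = refl
... | false = refl
length-filter-allSubsets (suc n) P? = begin
  length (filter P? (map (inside ∷_) A ++ map (outside ∷_) A))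
    ≡⟨ cong length (filter-++ P? (map (inside ∷_) A) _) ⟩
  length (filter P? (map (inside ∷_) A) ++ filter P? (map (outside ∷_) A))
    ≡⟨ length-++ (filter P? (map (inside ∷_) A)) ⟩
  length (filter P? (map (inside ∷_) A)) + length (filter P? (map (outside ∷_) A))
    ≡⟨ cong₂ _+_ (length-filter-map P? (inside ∷_) A) (length-filter-map P? (outside ∷_) A) ⟩
  length (filter (P? ∘ (inside ∷_)) A) + length (filter (P? ∘ (outside ∷_)) A)
    ≡⟨ cong₂ _+_ (length-filter-allSubsets n (P? ∘ (inside ∷_))) (length-filter-allSubsets n (P? ∘ (outside ∷_))) ⟩
  ∑ₛ (suc n) (𝟙 ∘ P?) ∎
  where A = allSubsets n

∑ₛ-𝟙-∣s∣≡0 : ∀ n → ∑ₛ n (λ s → 𝟙 (∣ s ∣ ≟ℕ 0)) ≡ 1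
∑ₛ-𝟙-∣s∣≡0 zero    = refl
∑ₛ-𝟙-∣s∣≡0 (suc n) = cong₂ _+_ (∑ₛ-zero n) (∑ₛ-𝟙-∣s∣≡0 n)

toggle : ∀ {n} → Fin n → Subset n → Subset n
toggle zero    (x ∷ s) = not x ∷ s
toggle (suc v) (x ∷ s) = x ∷ toggle v s

∑ₛ-toggle : ∀ n (v : Fin n) (h : Subset n → ℕ) → ∑ₛ n h ≡ ∑ₛ n (h ∘ toggle v)
∑ₛ-toggle (suc n) zero    h = +-comm (∑ₛ n (h ∘ (inside ∷_))) _
∑ₛ-toggle (suc n) (suc v) h =
  cong₂ _+_ (∑ₛ-toggle n v (h ∘ (inside ∷_))) (∑ₛ-toggle n v (h ∘ (outside ∷_)))

∈-toggle-self : ∀ {n} {v : Fin n} {s} → v ∉ s → v ∈ toggle v s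
∈-toggle-self {v = zero}  {s = inside  ∷ s} v∉s = ⊥-elim (v∉s here)
∈-toggle-self {v = zero}  {s = outside ∷ s} _   = here
∈-toggle-self {v = suc v} {s = x       ∷ s} v∉s = there (∈-toggle-self (v∉s ∘ there))

∉-toggle-self : ∀ {n} {v : Fin n} {s} → v ∈ s → v ∉ toggle v s
∉-toggle-self {v = zero}  here        ()
∉-toggle-self {v = suc v} (there v∈s) (there v∈t) = ∉-toggle-self v∈s v∈t

∈-toggle⁺ : ∀ {n} {u v : Fin n} {s} → u ≢ v → u ∈ s → u ∈ toggle v s
∈-toggle⁺ {u = zero}  {v = zero}  u≢v here        = ⊥-elim (u≢v refl)
∈-toggle⁺ {u = zero}  {v = suc v} u≢v here        = here
∈-toggle⁺ {u = suc u} {v = zero}  u≢v (there u∈s) = there u∈s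
∈-toggle⁺ {u = suc u} {v = suc v} u≢v (there u∈s) = there (∈-toggle⁺ (u≢v ∘ cong suc) u∈s)

∈-toggle⁻ : ∀ {n} {u v : Fin n} {s} → u ∈ toggle v s → u ≡ v ⊎ u ∈ s
∈-toggle⁻ {u = zero}  {v = zero}              _           = inj₁ refl
∈-toggle⁻ {u = zero}  {v = suc v} {s = x ∷ s} here        = inj₂ here
∈-toggle⁻ {u = suc u} {v = zero}  {s = x ∷ s} (there u∈t) = inj₂ (there u∈t)
∈-toggle⁻ {u = suc u} {v = suc v} {s = x ∷ s} (there u∈t) with ∈-toggle⁻ u∈t
... | inj₁ u≡v = inj₁ (cong suc u≡v)
... | inj₂ u∈s = inj₂ (there u∈s)

∣toggle∣ : ∀ {n} {v : Fin n} {s} → v ∉ s → ∣ toggle v s ∣ ≡ suc ∣ s ∣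
∣toggle∣ {v = zero}  {s = inside  ∷ s} v∉s = ⊥-elim (v∉s here)
∣toggle∣ {v = zero}  {s = outside ∷ s} _   = refl
∣toggle∣ {v = suc v} {s = inside  ∷ s} v∉s = cong suc (∣toggle∣ (v∉s ∘ there))
∣toggle∣ {v = suc v} {s = outside ∷ s} v∉s = ∣toggle∣ (v∉s ∘ there)

∣p∣≡∑𝟙∈ : ∀ {n} (p : Subset n) → ∣ p ∣ ≡ ∑[ v < n ] 𝟙 (v ∈? p)
∣p∣≡∑𝟙∈ []            = refl
∣p∣≡∑𝟙∈ (inside  ∷ p) = cong suc (∣p∣≡∑𝟙∈ p)
∣p∣≡∑𝟙∈ (outside ∷ p) = ∣p∣≡∑𝟙∈ p


Avoids : ∀ {n} → List (Fin n) → Fin n → Set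
Avoids xs x = All (_≢ x) xs

avoids? : ∀ {n} (xs : List (Fin n)) (x : Fin n) → Dec (Avoids xs x)
avoids? xs x = All.all? (λ y → ¬? (y ≟ᶠ x)) xs

∑𝟙-singleton : ∀ {n} (y : Fin n) → ∑[ x < n ] 𝟙 (y ≟ᶠ x) ≡ 1
∑𝟙-singleton {n} y = begin
  ∑[ x < n ] 𝟙 (y ≟ᶠ x)     ≡⟨ sum-cong-≗ (λ x → 𝟙-cong (y ≟ᶠ x) (x ∈? ⁅ y ⁆) (y≡x⇔x∈⁅y⁆ x)) ⟩
  ∑[ x < n ] 𝟙 (x ∈? ⁅ y ⁆) ≡⟨ ∣p∣≡∑𝟙∈ ⁅ y ⁆ ⟨
  ∣ ⁅ y ⁆ ∣                  ≡⟨ ∣⁅x⁆∣≡1 y ⟩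
  1                          ∎
  where
  y≡x⇔x∈⁅y⁆ : ∀ x → y ≡ x ⇔ x ∈ ⁅ y ⁆
  y≡x⇔x∈⁅y⁆ x = mk⇔ (λ { refl → x∈⁅x⁆ y }) (sym ∘ x∈⁅y⁆⇒x≡y y)

𝟙-avoids-∷ : ∀ {n} {y : Fin n} {xs} → All (y ≢_) xs → ∀ x →
             𝟙 (avoids? (y ∷ xs) x) + 𝟙 (y ≟ᶠ x) ≡ 𝟙 (avoids? xs x)
𝟙-avoids-∷ {y = y} {xs} y∉xs x with y ≟ᶠ x
... | yes refl = sym (𝟙-yes (avoids? xs y) (All.map (_∘ sym) y∉xs))
... | no  _    = +-identityʳ (𝟙 (avoids? xs x))

∑𝟙-avoids : ∀ {n} (xs : List (Fin n)) → Unique xs → ∑[ x < n ] 𝟙 (avoids? xs x) + length xs ≡ n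
∑𝟙-avoids {n} []       _             = trans (+-identityʳ _) (trans (∑-const n 1) (*-identityʳ n))
∑𝟙-avoids {n} (y ∷ xs) (y∉xs ∷ xs!) = begin
  ∑[ x < n ] 𝟙 (avoids? (y ∷ xs) x) + suc (length xs)
    ≡⟨ +-assoc _ 1 (length xs) ⟨
  ∑[ x < n ] 𝟙 (avoids? (y ∷ xs) x) + 1 + length xs
    ≡⟨ cong (λ k → ∑[ x < n ] 𝟙 (avoids? (y ∷ xs) x) + k + length xs) (∑𝟙-singleton y) ⟨
  ∑[ x < n ] 𝟙 (avoids? (y ∷ xs) x) + ∑[ x < n ] 𝟙 (y ≟ᶠ x) + length xs
    ≡⟨ cong (_+ length xs) (∑-distrib-+ (𝟙 ∘ avoids? (y ∷ xs)) (𝟙 ∘ (y ≟ᶠ_))) ⟨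
  ∑[ x < n ] (𝟙 (avoids? (y ∷ xs) x) + 𝟙 (y ≟ᶠ x)) + length xs
    ≡⟨ cong (_+ length xs) (sum-cong-≗ (𝟙-avoids-∷ y∉xs)) ⟩
  ∑[ x < n ] 𝟙 (avoids? xs x) + length xs
    ≡⟨ ∑𝟙-avoids xs xs! ⟩
  n ∎

-- Ordered and unordered cliques

Loopless : Graph → Set
Loopless G = ∀ v → ¬ Adj G v v

module _ (G : Graph) where

  AdjToAll : List (Fin (nV G)) → Fin (nV G) → Set
  AdjToAll ps v = All (λ p → Adj G p v) ps

  adjToAll? : ∀ ps v → Dec (AdjToAll ps v)
  adjToAll? ps v = All.all? (λ p → adj? G p v) ps

  -- Ordered cliques of k further vertices in the common neighbourhood of ps,
  -- each new vertex being prepended to ps.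
  orderedExtensions : List (Fin (nV G)) → ℕ → ℕ
  orderedExtensions ps zero    = 1
  orderedExtensions ps (suc k) = ∑[ v < nV G ] (𝟙 (adjToAll? ps v) * orderedExtensions (v ∷ ps) k)

  IsCommonClique : ℕ → List (Fin (nV G)) → Subset (nV G) → Set
  IsCommonClique k ps s = IsCliqueOfOrder G k s × (∀ u → u ∈ s → AdjToAll ps u)

  isCommonClique? : ∀ k ps s → Dec (IsCommonClique k ps s)
  isCommonClique? k ps s =
    (isClique? G s ×-dec (∣ s ∣ ≟ℕ k)) ×-dec all? (λ u → (u ∈? s) →-dec adjToAll? ps u)

  commonCliques : List (Fin (nV G)) → ℕ → ℕ
  commonCliques ps k = ∑ₛ (nV G) (𝟙 ∘ isCommonClique? k ps)

  numCliques≡commonCliques : ∀ m → numCliques G m ≡ commonCliques [] m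
  numCliques≡commonCliques m = trans (length-filter-allSubsets (nV G) clique?)
    (∑ₛ-cong (nV G) λ s → 𝟙-cong (clique? s) (isCommonClique? m [] s) (mk⇔ (_, λ _ _ → []) proj₁))
    where
    clique? : ∀ s → Dec (IsCliqueOfOrder G m s)
    clique? s = isClique? G s ×-dec (∣ s ∣ ≟ℕ m)

  commonCliques-zero : ∀ ps → commonCliques ps 0 ≡ 1
  commonCliques-zero ps =
    trans (∑ₛ-cong (nV G) λ s → 𝟙-cong (isCommonClique? 0 ps s) (∣ s ∣ ≟ℕ 0) (empty⇔ s)) (∑ₛ-𝟙-∣s∣≡0 (nV G))
    where
    ∉-empty : ∀ {s u} → ∣ s ∣ ≡ 0 → u ∉ s
    ∉-empty {s} {u} ∣s∣≡0 u∈s = n≮0 (subst (∣ s - u ∣ <_) ∣s∣≡0 (x∈p⇒∣p-x∣<∣p∣ u∈s))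
    empty⇔ : ∀ s → IsCommonClique 0 ps s ⇔ ∣ s ∣ ≡ 0
    empty⇔ s = mk⇔ (proj₂ ∘ proj₁) λ ∣s∣≡0 →
      ((λ u _ u∈s → ⊥-elim (∉-empty ∣s∣≡0 u∈s)) , ∣s∣≡0) , λ u u∈s → ⊥-elim (∉-empty ∣s∣≡0 u∈s)

  module _ (loopless : Loopless G) (adj-sym : Symmetric (Adj G)) where

    commonClique-toggle : ∀ {k ps v s} → v ∉ s →
      IsCommonClique (suc k) ps (toggle v s) ⇔ (AdjToAll ps v × IsCommonClique k (v ∷ ps) s)
    commonClique-toggle {k} {ps} {v} {s} v∉s = mk⇔ to from
      where
      s⊆t : ∀ {u} → u ∈ s → u ∈ toggle v s
      s⊆t u∈s = ∈-toggle⁺ (λ { refl → v∉s u∈s }) u∈s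

      v∈t : v ∈ toggle v s
      v∈t = ∈-toggle-self v∉s

      to : IsCommonClique (suc k) ps (toggle v s) → AdjToAll ps v × IsCommonClique k (v ∷ ps) s
      to ((clique , ∣t∣≡1+k) , adjPs) =
        adjPs v v∈t ,
        ((λ u w u∈s w∈s → clique u w (s⊆t u∈s) (s⊆t w∈s)) ,
         suc-injective (trans (sym (∣toggle∣ v∉s)) ∣t∣≡1+k)) ,
        λ u u∈s → clique v u v∈t (s⊆t u∈s) (λ { refl → v∉s u∈s }) ∷ adjPs u (s⊆t u∈s)

      from : AdjToAll ps v × IsCommonClique k (v ∷ ps) s → IsCommonClique (suc k) ps (toggle v s)
      from (adjPsv , (clique , ∣s∣≡k) , adjVPs) =
        (clique′ , trans (∣toggle∣ v∉s) (cong suc ∣s∣≡k)) , adjPs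
        where
        clique′ : IsClique G (toggle v s)
        clique′ u w u∈t w∈t u≢w with ∈-toggle⁻ u∈t | ∈-toggle⁻ w∈t
        ... | inj₁ refl | inj₁ refl = ⊥-elim (u≢w refl)
        ... | inj₁ refl | inj₂ w∈s  = All.head (adjVPs w w∈s)
        ... | inj₂ u∈s  | inj₁ refl = adj-sym (All.head (adjVPs u u∈s))
        ... | inj₂ u∈s  | inj₂ w∈s  = clique u w u∈s w∈s u≢w
        adjPs : ∀ u → u ∈ toggle v s → AdjToAll ps u
        adjPs u u∈t with ∈-toggle⁻ u∈t
        ... | inj₁ refl = adjPsv
        ... | inj₂ u∈s  = All.tail (adjVPs u u∈s)

    𝟙-toggle : ∀ k ps v s →
      𝟙 (v ∈? toggle v s) * 𝟙 (isCommonClique? (suc k) ps (toggle v s))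
        ≡ 𝟙 (adjToAll? ps v) * 𝟙 (isCommonClique? k (v ∷ ps) s)
    𝟙-toggle k ps v s = by-membership (v ∈? s)
      where
      adj = adjToAll? ps v
      cl  = isCommonClique? k (v ∷ ps) s
      cl′ = isCommonClique? (suc k) ps (toggle v s)
      by-membership : Dec (v ∈ s) → 𝟙 (v ∈? toggle v s) * 𝟙 cl′ ≡ 𝟙 adj * 𝟙 cl
      by-membership (yes v∈s) = begin
        𝟙 (v ∈? toggle v s) * 𝟙 cl′ ≡⟨ cong (_* 𝟙 cl′) (𝟙-no (v ∈? toggle v s) (∉-toggle-self v∈s)) ⟩
        0                           ≡⟨ *-zeroʳ (𝟙 adj) ⟨
        𝟙 adj * 0                   ≡⟨ cong (𝟙 adj *_) (𝟙-no cl (λ (_ , adjVPs) → loopless v (All.head (adjVPs v v∈s)))) ⟨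
        𝟙 adj * 𝟙 cl                ∎
      by-membership (no v∉s) = begin
        𝟙 (v ∈? toggle v s) * 𝟙 cl′ ≡⟨ cong (_* 𝟙 cl′) (𝟙-yes (v ∈? toggle v s) (∈-toggle-self v∉s)) ⟩
        1 * 𝟙 cl′                   ≡⟨ *-identityˡ (𝟙 cl′) ⟩
        𝟙 cl′                       ≡⟨ 𝟙-cong cl′ (adj ×-dec cl) (commonClique-toggle v∉s) ⟩
        𝟙 (adj ×-dec cl)            ≡⟨ 𝟙-× adj cl ⟩
        𝟙 adj * 𝟙 cl                ∎

    suc-*-commonCliques : ∀ k ps →
      suc k * commonCliques ps (suc k) ≡ ∑[ v < nV G ] (𝟙 (adjToAll? ps v) * commonCliques (v ∷ ps) k)
    suc-*-commonCliques k ps = begin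
      suc k * ∑ₛ n c
        ≡⟨ *-distribˡ-∑ₛ n (suc k) c ⟩
      ∑ₛ n (λ s → suc k * c s)
        ≡⟨ ∑ₛ-cong n (λ s → *-𝟙-cong (isCommonClique? (suc k) ps s) (sym ∘ proj₂ ∘ proj₁)) ⟩
      ∑ₛ n (λ s → ∣ s ∣ * c s)
        ≡⟨ ∑ₛ-cong n (λ s → cong (_* c s) (∣p∣≡∑𝟙∈ s)) ⟩
      ∑ₛ n (λ s → (∑[ v < n ] 𝟙 (v ∈? s)) * c s)
        ≡⟨ ∑ₛ-cong n (λ s → *-distribʳ-sum (c s) (λ v → 𝟙 (v ∈? s))) ⟩
      ∑ₛ n (λ s → ∑[ v < n ] (𝟙 (v ∈? s) * c s))
        ≡⟨ ∑-∑ₛ-comm n n (λ v s → 𝟙 (v ∈? s) * c s) ⟨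
      ∑[ v < n ] ∑ₛ n (λ s → 𝟙 (v ∈? s) * c s)
        ≡⟨ sum-cong-≗ (λ v → ∑ₛ-toggle n v (λ s → 𝟙 (v ∈? s) * c s)) ⟩
      ∑[ v < n ] ∑ₛ n (λ s → 𝟙 (v ∈? toggle v s) * c (toggle v s))
        ≡⟨ sum-cong-≗ (λ v → ∑ₛ-cong n (𝟙-toggle k ps v)) ⟩
      ∑[ v < n ] ∑ₛ n (λ s → 𝟙 (adjToAll? ps v) * 𝟙 (isCommonClique? k (v ∷ ps) s))
        ≡⟨ sum-cong-≗ (λ v → *-distribˡ-∑ₛ n (𝟙 (adjToAll? ps v)) (𝟙 ∘ isCommonClique? k (v ∷ ps))) ⟨
      ∑[ v < n ] (𝟙 (adjToAll? ps v) * commonCliques (v ∷ ps) k) ∎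
      where
      n = nV G
      c = 𝟙 ∘ isCommonClique? (suc k) ps

    factorial-*-commonCliques : ∀ k ps → k ! * commonCliques ps k ≡ orderedExtensions ps k
    factorial-*-commonCliques zero    ps = trans (+-identityʳ _) (commonCliques-zero ps)
    factorial-*-commonCliques (suc k) ps = begin
      suc k * k ! * commonCliques ps (suc k)
        ≡⟨ xy∙z≈y∙xz (suc k) (k !) _ ⟩
      k ! * (suc k * commonCliques ps (suc k))
        ≡⟨ cong (k ! *_) (suc-*-commonCliques k ps) ⟩
      k ! * ∑[ v < nV G ] (𝟙 (adjToAll? ps v) * commonCliques (v ∷ ps) k)
        ≡⟨ *-distribˡ-sum (k !) (λ v → 𝟙 (adjToAll? ps v) * commonCliques (v ∷ ps) k) ⟩
      ∑[ v < nV G ] (k ! * (𝟙 (adjToAll? ps v) * commonCliques (v ∷ ps) k))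
        ≡⟨ sum-cong-≗ (λ v → x∙yz≈y∙xz (k !) (𝟙 (adjToAll? ps v)) _) ⟩
      ∑[ v < nV G ] (𝟙 (adjToAll? ps v) * (k ! * commonCliques (v ∷ ps) k))
        ≡⟨ sum-cong-≗ (λ v → cong (𝟙 (adjToAll? ps v) *_) (factorial-*-commonCliques k (v ∷ ps))) ⟩
      orderedExtensions ps (suc k) ∎

    factorial-*-numCliques : ∀ m → m ! * numCliques G m ≡ orderedExtensions [] m
    factorial-*-numCliques m =
      trans (cong (m ! *_) (numCliques≡commonCliques m)) (factorial-*-commonCliques m [])

-- Direct products

module _ (G H : Graph) where

  adjToAll-⊗ : ∀ ps w → AdjToAll (G ⊗ H) ps w ⇔
    (AdjToAll G (map (fstV G H) ps) (fstV G H w) × AdjToAll H (map (sndV G H) ps) (sndV G H w))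
  adjToAll-⊗ ps w = mk⇔
    (λ adj → let (adjG , adjH) = All.unzip adj in map⁺ adjG , map⁺ adjH)
    (λ (adjG , adjH) → All.zip (map⁻ adjG , map⁻ adjH))

  orderedExtensions-⊗ : ∀ k ps → orderedExtensions (G ⊗ H) ps k ≡
    orderedExtensions G (map (fstV G H) ps) k * orderedExtensions H (map (sndV G H) ps) k
  orderedExtensions-⊗ zero    ps = refl
  orderedExtensions-⊗ (suc k) ps = begin
    ∑[ w < nV G * nV H ] (𝟙 (adjToAll? (G ⊗ H) ps w) * orderedExtensions (G ⊗ H) (w ∷ ps) k)
      ≡⟨ sum-cong-≗ factorise ⟩
    ∑[ w < nV G * nV H ] (F (fstV G H w) * F′ (sndV G H w))
      ≡⟨ ∑-remQuot (nV G) (nV H) (λ xy → F (proj₁ xy) * F′ (proj₂ xy)) ⟩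
    ∑[ x < nV G ] ∑[ y < nV H ] (F x * F′ y)
      ≡⟨ sum-cong-≗ (λ x → *-distribˡ-sum (F x) F′) ⟨
    ∑[ x < nV G ] (F x * ∑[ y < nV H ] F′ y)
      ≡⟨ *-distribʳ-sum (∑[ y < nV H ] F′ y) F ⟨
    ∑[ x < nV G ] F x * ∑[ y < nV H ] F′ y ∎
    where
    F : Fin (nV G) → ℕ
    F x = 𝟙 (adjToAll? G (map (fstV G H) ps) x) * orderedExtensions G (x ∷ map (fstV G H) ps) k
    F′ : Fin (nV H) → ℕ
    F′ y = 𝟙 (adjToAll? H (map (sndV G H) ps) y) * orderedExtensions H (y ∷ map (sndV G H) ps) k
    factorise : ∀ w → 𝟙 (adjToAll? (G ⊗ H) ps w) * orderedExtensions (G ⊗ H) (w ∷ ps) k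
                      ≡ F (fstV G H w) * F′ (sndV G H w)
    factorise w = begin
      𝟙 adj * orderedExtensions (G ⊗ H) (w ∷ ps) k
        ≡⟨ cong₂ _*_ (𝟙-cong adj (adjG ×-dec adjH) (adjToAll-⊗ ps w)) (orderedExtensions-⊗ k (w ∷ ps)) ⟩
      𝟙 (adjG ×-dec adjH) * (extG * extH)
        ≡⟨ cong (_* (extG * extH)) (𝟙-× adjG adjH) ⟩
      𝟙 adjG * 𝟙 adjH * (extG * extH)
        ≡⟨ interchange (𝟙 adjG) (𝟙 adjH) extG extH ⟩
      F (fstV G H w) * F′ (sndV G H w) ∎
      where
      adj  = adjToAll? (G ⊗ H) ps w
      adjG = adjToAll? G (map (fstV G H) ps) (fstV G H w)
      adjH = adjToAll? H (map (sndV G H) ps) (sndV G H w)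
      extG = orderedExtensions G (fstV G H w ∷ map (fstV G H) ps) k
      extH = orderedExtensions H (sndV G H w ∷ map (sndV G H) ps) k

  ⊗-loopless : Loopless G → Loopless (G ⊗ H)
  ⊗-loopless G-loopless w (adjG , _) = G-loopless (fstV G H w) adjG

  ⊗-symmetric : Symmetric (Adj G) → Symmetric (Adj H) → Symmetric (Adj (G ⊗ H))
  ⊗-symmetric G-sym H-sym (adjG , adjH) = G-sym adjG , H-sym adjH

∏G-loopless : ∀ r (H : Fin (suc r) → Graph) → Loopless (H zero) → Loopless (∏G r H)
∏G-loopless zero    H = id
∏G-loopless (suc r) H = ⊗-loopless (H zero) (∏G r (H ∘ suc))

∏G-symmetric : ∀ r (H : Fin (suc r) → Graph) → (∀ i → Symmetric (Adj (H i))) → Symmetric (Adj (∏G r H))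
∏G-symmetric zero    H H-sym = H-sym zero
∏G-symmetric (suc r) H H-sym =
  ⊗-symmetric (H zero) (∏G r (H ∘ suc)) (H-sym zero) (∏G-symmetric r (H ∘ suc) (H-sym ∘ suc))

orderedExtensions-∏G : ∀ r (H : Fin (suc r) → Graph) m →
  orderedExtensions (∏G r H) [] m ≡ ∏ (suc r) (λ i → orderedExtensions (H i) [] m)
orderedExtensions-∏G zero    H m = sym (*-identityʳ _)
orderedExtensions-∏G (suc r) H m =
  trans (orderedExtensions-⊗ (H zero) (∏G r (H ∘ suc)) m [])
        (cong (orderedExtensions (H zero) [] m *_) (orderedExtensions-∏G r (H ∘ suc) m))

∏₁-cong : ∀ k {f g : ℕ → ℕ} → (∀ i → f i ≡ g i) → ∏₁ k f ≡ ∏₁ k g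
∏₁-cong zero    f≗g = refl
∏₁-cong (suc k) f≗g = cong₂ _*_ (∏₁-cong k f≗g) (f≗g (suc k))

∏₁-suc : ∀ k (f : ℕ → ℕ) → ∏₁ (suc k) f ≡ f 1 * ∏₁ k (f ∘ suc)
∏₁-suc zero    f = *-comm 1 (f 1)
∏₁-suc (suc k) f = trans (cong (_* f (2 + k)) (∏₁-suc k f)) (*-assoc (f 1) _ (f (2 + k)))

∏-cong : ∀ n {f g : Fin n → ℕ} → (∀ i → f i ≡ g i) → ∏ n f ≡ ∏ n g
∏-cong zero    f≗g = refl
∏-cong (suc n) f≗g = cong₂ _*_ (f≗g zero) (∏-cong n (f≗g ∘ suc))

∏-distrib-* : ∀ n (f g : Fin n → ℕ) → ∏ n (λ i → f i * g i) ≡ ∏ n f * ∏ n g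
∏-distrib-* zero    f g = refl
∏-distrib-* (suc n) f g =
  trans (cong (f zero * g zero *_) (∏-distrib-* n (f ∘ suc) (g ∘ suc)))
        (interchange (f zero) (g zero) (∏ n (f ∘ suc)) (∏ n (g ∘ suc)))

∏-one : ∀ n → ∏ n (λ _ → 1) ≡ 1
∏-one zero    = refl
∏-one (suc n) = trans (+-identityʳ _) (∏-one n)

∏-∏₁-comm : ∀ n m (f : Fin n → ℕ → ℕ) → ∏ n (λ i → ∏₁ m (f i)) ≡ ∏₁ m (λ k → ∏ n (λ i → f i k))
∏-∏₁-comm n zero    f = ∏-one n
∏-∏₁-comm n (suc m) f =
  trans (∏-distrib-* n (λ i → ∏₁ m (f i)) (λ i → f i (suc m)))
        (cong (_* ∏ n (λ i → f i (suc m))) (∏-∏₁-comm n m f))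

-- Complete multipartite graphs

module _ (a b : ℕ) where

  adjToAll-K : ∀ ps v → AdjToAll (K a b) ps v ⇔ Avoids (map (part a b) ps) (part a b v)
  adjToAll-K ps v = mk⇔ map⁺ map⁻

  commonNeighbours-K : ∀ ps → Unique (map (part a b) ps) →
    ∑[ v < b * a ] 𝟙 (adjToAll? (K a b) ps v) ≡ a * (b ∸ length ps)
  commonNeighbours-K ps unique = begin
    ∑[ v < b * a ] 𝟙 (adjToAll? (K a b) ps v)
      ≡⟨ sum-cong-≗ (λ v → 𝟙-cong (adjToAll? (K a b) ps v) (avoids? qs (part a b v)) (adjToAll-K ps v)) ⟩
    ∑[ v < b * a ] 𝟙 (avoids? qs (quotient a v))
      ≡⟨ ∑-remQuot b a (λ xy → 𝟙 (avoids? qs (proj₁ xy))) ⟩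
    ∑[ x < b ] ∑[ y < a ] 𝟙 (avoids? qs x)
      ≡⟨ sum-cong-≗ (λ x → ∑-const a (𝟙 (avoids? qs x))) ⟩
    ∑[ x < b ] (a * 𝟙 (avoids? qs x))
      ≡⟨ *-distribˡ-sum a (𝟙 ∘ avoids? qs) ⟨
    a * ∑[ x < b ] 𝟙 (avoids? qs x)
      ≡⟨ cong (a *_) free-parts ⟩
    a * (b ∸ length ps) ∎
    where
    qs = map (part a b) ps
    free-parts : ∑[ x < b ] 𝟙 (avoids? qs x) ≡ b ∸ length ps
    free-parts = begin
      ∑[ x < b ] 𝟙 (avoids? qs x)
        ≡⟨ m+n∸n≡m _ (length qs) ⟨
      ∑[ x < b ] 𝟙 (avoids? qs x) + length qs ∸ length qs
        ≡⟨ cong₂ _∸_ (∑𝟙-avoids qs unique) (length-map (part a b) ps) ⟩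
      b ∸ length ps ∎

  orderedExtensions-K : ∀ k ps → Unique (map (part a b) ps) →
    orderedExtensions (K a b) ps k ≡ ∏₁ k (λ i → 𝒮 (length ps + i ∸ 1) a b)
  orderedExtensions-K zero    ps _      = refl
  orderedExtensions-K (suc k) ps unique = begin
    ∑[ v < b * a ] (𝟙 (adjToAll? (K a b) ps v) * orderedExtensions (K a b) (v ∷ ps) k)
      ≡⟨ sum-cong-≗ (λ v → 𝟙-*-cong (adjToAll? (K a b) ps v) (λ adj → orderedExtensions-K k (v ∷ ps) (extend adj))) ⟩
    ∑[ v < b * a ] (𝟙 (adjToAll? (K a b) ps v) * rest)
      ≡⟨ *-distribʳ-sum rest (𝟙 ∘ adjToAll? (K a b) ps) ⟨
    ∑[ v < b * a ] 𝟙 (adjToAll? (K a b) ps v) * rest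
      ≡⟨ cong (_* rest) (commonNeighbours-K ps unique) ⟩
    𝒮 (length ps) a b * rest
      ≡⟨ cong₂ _*_ f-one (∏₁-cong k f-suc) ⟨
    f 1 * ∏₁ k (f ∘ suc)
      ≡⟨ ∏₁-suc k f ⟨
    ∏₁ (suc k) f ∎
    where
    f : ℕ → ℕ
    f i = 𝒮 (length ps + i ∸ 1) a b
    f-one : f 1 ≡ 𝒮 (length ps) a b
    f-one = cong (λ j → 𝒮 j a b) (m+n∸n≡m (length ps) 1)
    f-suc : ∀ i → f (suc i) ≡ 𝒮 (length ps + i) a b
    f-suc i = cong (λ j → 𝒮 (j ∸ 1) a b) (+-suc (length ps) i)
    rest = ∏₁ k (λ i → 𝒮 (length ps + i) a b)
    extend : ∀ {v} → AdjToAll (K a b) ps v → Unique (map (part a b) (v ∷ ps))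
    extend adj = All.map ≢-sym (map⁺ adj) ∷ unique

  K-loopless : Loopless (K a b)
  K-loopless v part≢part = part≢part refl

  K-symmetric : Symmetric (Adj (K a b))
  K-symmetric = _∘ sym

mainTheorem1 : (r : ℕ) (a b : Fin (suc r) → ℕ) (m : ℕ) →
    (∀ i → a i > 0) → (∀ i → b i > 0) → m > 0 →
    m ! * numCliques (∏G r (λ i → K (a i) (b i))) m
      ≡ ∏₁ m (λ k → ∏ (suc r) (λ i → 𝒮 (k ∸ 1) (a i) (b i)))
mainTheorem1 r a b m _ _ _ = begin
  m ! * numCliques X m
    ≡⟨ factorial-*-numCliques X (∏G-loopless r H (K-loopless (a zero) (b zero)))
                                (∏G-symmetric r H (λ i → K-symmetric (a i) (b i))) m ⟩
  orderedExtensions X [] m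
    ≡⟨ orderedExtensions-∏G r H m ⟩
  ∏ (suc r) (λ i → orderedExtensions (H i) [] m)
    ≡⟨ ∏-cong (suc r) (λ i → orderedExtensions-K (a i) (b i) m [] []) ⟩
  ∏ (suc r) (λ i → ∏₁ m (λ k → 𝒮 (k ∸ 1) (a i) (b i)))
    ≡⟨ ∏-∏₁-comm (suc r) m (λ i k → 𝒮 (k ∸ 1) (a i) (b i)) ⟩
  ∏₁ m (λ k → ∏ (suc r) (λ i → 𝒮 (k ∸ 1) (a i) (b i))) ∎
  where
  H : Fin (suc r) → Graph
  H i = K (a i) (b i)
  X = ∏G r H
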